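{- For each integer $n\ge 1$ there exists a Steiner triple system $M$ of order $6n+1$ such that $\mathcal{D}(M,3)\ge 5n+1$. Consequently $\mathcal{D}(6n+1,3)\ge 5n+1$.
   Context: A Steiner triple system of order $v$, $\mathrm{STS}(v)$, is a pair $(V,\mathcal{B})$ where $|V|=v$ and $\mathcal{B}$ is a collection of $3$-subsets of $V$ (blocks) such that every $2$-subset of $V$ lies in exactly one block. A $3$-coloring is a map $\phi:V\to C$ with $|C|=3$ such that no block is monochromatic. A defining set of a $3$-coloring $\phi$ is a subset $S\subseteq V$ together with the colors $\phi|_S$ such that $\phi$ is the unique $3$-coloring of $(V,\mathcal{B})$ extending $\phi|_S$. A defining set is minimal if no proper subset of it (with the restricted colors) is a defining set of the same coloring. For an $\mathrm{STS}(v)$ $D$ admitting a $3$-coloring, $\mathcal{D}(D,3)$ is the largest cardinality of a minimal defining set of a $3$-coloring of $D$ (maximum over all $3$-colorings and all their minimal defining sets), and $\mathcal{D}(v,3)=\max\{\mathcal{D}(D,3)\}$ over all $3$-chromatic Steiner triple systems $D$ of order $v$. -}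

module Defs where

open import Data.Nat using (ℕ; _≥_)
open import Data.Fin using (Fin)
open import Data.Fin.Subset using (Subset; _∈_; _⊂_; ∣_∣)
open import Data.Product using (Σ; ∃; _×_)
open import Relation.Nullary using (¬_)
open import Relation.Binary.PropositionalEquality using (_≡_; _≢_)

record STS (v : ℕ) : Set₁ where
  field
    Block     : Subset v → Set
    block-3   : ∀ B → Block B → ∣ B ∣ ≡ 3
    pair-cov  : ∀ x y → x ≢ y → Σ (Subset v) λ B → Block B × x ∈ B × y ∈ B
    pair-uniq : ∀ x y → x ≢ y → ∀ B B′ →
                Block B → x ∈ B → y ∈ B →
                Block B′ → x ∈ B′ → y ∈ B′ → B ≡ B′
open STS public

IsColoring : ∀ {v} (D : STS v) (k : ℕ) → (Fin v → Fin k) → Set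
IsColoring {v} D k φ =
  ∀ B → Block D B → ¬ (Σ (Fin k) λ c → ∀ x → x ∈ B → φ x ≡ c)

ThreeChromatic : ∀ {v} → STS v → Set
ThreeChromatic {v} D =
  (Σ (Fin v → Fin 3) λ φ → IsColoring D 3 φ) ×
  ¬ (Σ (Fin v → Fin 2) λ ψ → IsColoring D 2 ψ)

IsDefiningSet : ∀ {v} (D : STS v) → (Fin v → Fin 3) → Subset v → Set
IsDefiningSet {v} D φ S =
  ∀ ψ → IsColoring D 3 ψ → (∀ x → x ∈ S → ψ x ≡ φ x) → ∀ x → ψ x ≡ φ x

IsMinimalDefiningSet : ∀ {v} (D : STS v) → (Fin v → Fin 3) → Subset v → Set
IsMinimalDefiningSet D φ S =
  IsDefiningSet D φ S × (∀ T → T ⊂ S → ¬ IsDefiningSet D φ T)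

𝒟≥ : ∀ {v} → STS v → ℕ → Set
𝒟≥ {v} D m =
  Σ (Fin v → Fin 3) λ φ → IsColoring D 3 φ ×
  Σ (Subset v) λ S → IsMinimalDefiningSet D φ S × ∣ S ∣ ≥ m

module Submission where

-- Skolem's construction: a commutative quasigroup (Q, ∘) of order 2n with a ∘ a = a′ ∘ a′ = a
-- (a′ = a + n, a < n) gives a Steiner quasigroup on {∞} ∪ Q × ℤ₃, hence an STS(6n + 1).
-- Color ∞ by 0 and every other point by its level.  This coloring is proper, and the n points
-- (a′, 2) are forced by the others: (a′, 2) lies on a line with ∞ and (a, 0), and on a line
-- with two points of level 1, which excludes colors 0 and 1.  Every other point can be moved
-- to color level + 1 without creating a monochromatic line, so none of the remaining 5n + 1
-- points can be dropped: they form a minimal defining set.  The system is 3-chromatic since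
-- no STS on at least 5 points is 2-colorable: counting through the involution y ↦ x · y shows
-- that a line colored c, d, d forces fewer points of color c than of color d, and lines of
-- both kinds exist.

open import Defs
open import Data.Nat using (ℕ; zero; suc; _+_; _*_; _∸_; _≤_; _<_; _≥_; _<?_; z≤n; s≤s; ⌊_/2⌋; parity)
open import Data.Nat.Properties
  using (+-0-commutativeMonoid; module ≤-Reasoning; +-assoc; +-comm; +-suc; +-identityʳ;
         +-mono-≤; +-monoˡ-≤; +-mono-<; +-mono-≤-<; +-monoʳ-<; +-cancelˡ-<; *-monoʳ-≤;
         ≤-refl; ≤-reflexive; ≤-trans; ≤-pred; <-≤-trans; <⇒≤; <-asym; ≤⇒≯; ≮⇒≥;
         m≤m+n; m+n≮m; m+[n∸m]≡n; m+n∸m≡n)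
open import Data.Nat.DivMod using (_%_; _mod_; m%n<n; %-distribˡ-+; m%n%n≡m%n; [m+n]%n≡m%n; m<n⇒m%n≡m)
open import Data.Nat.Solver using (module +-*-Solver)
open import Data.Parity.Base using (Parity; 0ℙ; 1ℙ)
open import Data.Bool using (Bool; true; false; if_then_else_)
open import Data.Fin using (Fin; zero; suc; toℕ; _↑ˡ_; _↑ʳ_; splitAt; combine; remQuot)
open import Data.Fin.Patterns using (0F; 1F; 2F; 3F; 4F; 5F)
open import Data.Fin.Properties
  using (_≟_; pigeonhole; <⇒≢; any?; toℕ<n; toℕ-fromℕ<; toℕ-injective;
         splitAt-↑ˡ; splitAt-↑ʳ; splitAt⁻¹-↑ˡ; splitAt⁻¹-↑ʳ; remQuot-combine; combine-remQuot)
open import Data.Fin.Permutation using (permutation)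
open import Data.Fin.Subset using (Subset; _∈_; _∉_; _⊂_; ⁅_⁆; _∪_; ∣_∣; inside; outside)
  renaming (⊥ to ∅; ⊤ to full)
open import Data.Fin.Subset.Properties
  using (x∈p∪q⁻; x∈p∪q⁺; x∈⁅x⁆; x∈⁅y⁆⇒x≡y; _∈?_; ∪-comm; ∪-assoc; ∪-identityˡ;
         ∣⁅x⁆∣≡1; ∣⊥∣≡0; ∣⊤∣≡n)
open import Data.Vec using ([]; _∷_; _++_; lookup; here; there)
open import Data.Vec.Properties using (lookup-++ˡ; lookup-++ʳ; lookup-replicate; []=⇒lookup; lookup⇒[]=)
open import Data.Vec.Functional using (replicate)
open import Data.Product using (Σ; ∃; ∃₂; _×_; _,_; proj₁; proj₂)
open import Data.Sum using (_⊎_; inj₁; inj₂)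
open import Data.Empty using (⊥; ⊥-elim)
open import Function using (_∘′_)
open import Relation.Nullary using (¬_; Dec; yes; no; does; ¬?; contradiction)
open import Relation.Nullary.Decidable using (_×-dec_; decidable-stable)
open import Relation.Binary.Definitions using (DecidableEquality)
open import Relation.Binary.PropositionalEquality
open import Algebra.Properties.CommutativeMonoid.Sum +-0-commutativeMonoid
  using (sum; sum-syntax; ∑-permute; ∑-distrib-+; sum-cong-≗; sum-replicate-zero)

𝟙 : ∀ {a} {A : Set a} → Dec A → ℕ
𝟙 d = if does d then 1 else 0

∑-mono-≤ : ∀ {v} {f g : Fin v → ℕ} → (∀ u → f u ≤ g u) → sum f ≤ sum g
∑-mono-≤ {zero} f≤g = z≤n
∑-mono-≤ {suc v} f≤g = +-mono-≤ (f≤g zero) (∑-mono-≤ (λ u → f≤g (suc u)))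

∑-const-1 : ∀ v → ∑[ u < v ] 1 ≡ v
∑-const-1 zero = refl
∑-const-1 (suc v) = cong suc (∑-const-1 v)

∑-singleton : ∀ {v} (x : Fin v) → ∑[ u < v ] 𝟙 (u ≟ x) ≡ 1
∑-singleton {suc v} zero =
  cong suc (trans (sum-cong-≗ {v} {_} {replicate v 0} (λ _ → refl)) (sum-replicate-zero v))
∑-singleton {suc v} (suc x) = ∑-singleton x

𝟙-yes : ∀ {a} {A : Set a} (a? : Dec A) → A → 𝟙 a? ≡ 1
𝟙-yes (yes _) _ = refl
𝟙-yes (no ¬a) a = ⊥-elim (¬a a)

𝟙-no : ∀ {a} {A : Set a} (a? : Dec A) → ¬ A → 𝟙 a? ≡ 0
𝟙-no (yes a) ¬a = ⊥-elim (¬a a)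
𝟙-no (no _) _ = refl

𝟙-≤ : ∀ {a b} {A : Set a} {B : Set b} (a? : Dec A) (b? : Dec B) → (A → B) → 𝟙 a? ≤ 𝟙 b?
𝟙-≤ (yes a) (yes _) _ = ≤-refl
𝟙-≤ (yes a) (no ¬b) f = ⊥-elim (¬b (f a))
𝟙-≤ (no _) _ _ = z≤n

𝟙≤1 : ∀ {a} {A : Set a} (a? : Dec A) → 𝟙 a? ≤ 1
𝟙≤1 (yes _) = ≤-refl
𝟙≤1 (no _) = z≤n

≢-≢⇒≡ : ∀ {a b c : Fin 2} → a ≢ c → b ≢ c → a ≡ b
≢-≢⇒≡ {0F} {0F} _ _ = refl
≢-≢⇒≡ {1F} {1F} _ _ = refl
≢-≢⇒≡ {0F} {1F} {0F} a≢c _ = ⊥-elim (a≢c refl)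
≢-≢⇒≡ {0F} {1F} {1F} _ b≢c = ⊥-elim (b≢c refl)
≢-≢⇒≡ {1F} {0F} {0F} _ b≢c = ⊥-elim (b≢c refl)
≢-≢⇒≡ {1F} {0F} {1F} a≢c _ = ⊥-elim (a≢c refl)

𝟙-fin2-partition : ∀ {c d : Fin 2} → c ≢ d → ∀ a → 𝟙 (a ≟ c) + 𝟙 (a ≟ d) ≡ 1
𝟙-fin2-partition {0F} {0F} c≢d _ = ⊥-elim (c≢d refl)
𝟙-fin2-partition {0F} {1F} _ 0F = refl
𝟙-fin2-partition {0F} {1F} _ 1F = refl
𝟙-fin2-partition {1F} {0F} _ 0F = refl
𝟙-fin2-partition {1F} {0F} _ 1F = refl
𝟙-fin2-partition {1F} {1F} c≢d _ = ⊥-elim (c≢d refl)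

5≤m+n⇒n≤1+m⇒2≤m : ∀ {m n} → 5 ≤ m + n → n ≤ suc m → 2 ≤ m
5≤m+n⇒n≤1+m⇒2≤m {0} 5≤n n≤1 with ≤-trans 5≤n n≤1
... | s≤s ()
5≤m+n⇒n≤1+m⇒2≤m {1} (s≤s 4≤n) n≤2 with ≤-trans 4≤n n≤2
... | s≤s (s≤s ())
5≤m+n⇒n≤1+m⇒2≤m {suc (suc m)} _ _ = s≤s (s≤s z≤n)

-- Steiner triple systems

∣⁅x⁆∪p∣ : ∀ {v} (x : Fin v) (p : Subset v) → x ∉ p → ∣ ⁅ x ⁆ ∪ p ∣ ≡ suc ∣ p ∣
∣⁅x⁆∪p∣ zero (inside ∷ p) x∉p = ⊥-elim (x∉p here)
∣⁅x⁆∪p∣ zero (outside ∷ p) _ = cong suc (cong ∣_∣ (∪-identityˡ p))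
∣⁅x⁆∪p∣ (suc x) (inside ∷ p) x∉p = cong suc (∣⁅x⁆∪p∣ x p (λ x∈p → x∉p (there x∈p)))
∣⁅x⁆∪p∣ (suc x) (outside ∷ p) x∉p = ∣⁅x⁆∪p∣ x p (λ x∈p → x∉p (there x∈p))

∣p++q∣ : ∀ {a b} (p : Subset a) (q : Subset b) → ∣ p ++ q ∣ ≡ ∣ p ∣ + ∣ q ∣
∣p++q∣ [] q = refl
∣p++q∣ (inside ∷ p) q = cong suc (∣p++q∣ p q)
∣p++q∣ (outside ∷ p) q = ∣p++q∣ p q

minimal-if-recolorable :
  ∀ {v} (D : STS v) {φ : Fin v → Fin 3} {S : Subset v} → IsDefiningSet D φ S →
  (∀ y → y ∈ S → Σ (Fin v → Fin 3) λ ψ →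
     IsColoring D 3 ψ × (∀ x → x ≢ y → ψ x ≡ φ x) × ψ y ≢ φ y) →
  IsMinimalDefiningSet D φ S
minimal-if-recolorable D {φ} {S} defining recolorable = defining , no-defining-proper-subset
  where
  no-defining-proper-subset : ∀ T → T ⊂ S → ¬ IsDefiningSet D φ T
  no-defining-proper-subset T (_ , y , y∈S , y∉T) T-defining with recolorable y y∈S
  ... | ψ , coloring , agree , differ = differ (T-defining ψ coloring agree-on-T y)
    where
    agree-on-T : ∀ x → x ∈ T → ψ x ≡ φ x
    agree-on-T x x∈T = agree x λ { refl → y∉T x∈T }

Proper : ∀ {A : Set} → (A → A → A) → ∀ {k} → (A → Fin k) → Set
Proper _·_ ψ = ∀ x y → x ≢ y → ψ x ≡ ψ y → ψ (x · y) ≢ ψ x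

module SteinerQuasigroup {v : ℕ} (_·_ : Fin v → Fin v → Fin v)
  (·-idem : ∀ x → x · x ≡ x)
  (·-comm : ∀ x y → x · y ≡ y · x)
  (·-involutive : ∀ x y → x · (x · y) ≡ y) where

  ·-≡ˡ⇒≡ : ∀ {x y} → x · y ≡ x → x ≡ y
  ·-≡ˡ⇒≡ {x} {y} e = sym (trans (sym (·-involutive x y)) (trans (cong (x ·_) e) (·-idem x)))

  ·-≢ˡ : ∀ {x y} → x ≢ y → x · y ≢ x
  ·-≢ˡ x≢y e = x≢y (·-≡ˡ⇒≡ e)

  ·-≢ʳ : ∀ {x y} → x ≢ y → x · y ≢ y
  ·-≢ʳ {x} {y} x≢y e = ·-≢ˡ (λ e′ → x≢y (sym e′)) (trans (·-comm y x) e)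

  line : Fin v → Fin v → Subset v
  line x y = ⁅ x ⁆ ∪ ⁅ y ⁆ ∪ ⁅ x · y ⁆

  ∈-line⁻ : ∀ {x y z} → z ∈ line x y → z ≡ x ⊎ z ≡ y ⊎ z ≡ x · y
  ∈-line⁻ {x} {y} z∈ with x∈p∪q⁻ ⁅ x ⁆ _ z∈
  ... | inj₁ z∈x = inj₁ (x∈⁅y⁆⇒x≡y x z∈x)
  ... | inj₂ z∈yxy with x∈p∪q⁻ ⁅ y ⁆ _ z∈yxy
  ...   | inj₁ z∈y = inj₂ (inj₁ (x∈⁅y⁆⇒x≡y y z∈y))
  ...   | inj₂ z∈xy = inj₂ (inj₂ (x∈⁅y⁆⇒x≡y _ z∈xy))

  x∈line : ∀ x y → x ∈ line x y
  x∈line x y = x∈p∪q⁺ (inj₁ (x∈⁅x⁆ x))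

  y∈line : ∀ x y → y ∈ line x y
  y∈line x y = x∈p∪q⁺ {p = ⁅ x ⁆} (inj₂ (x∈p∪q⁺ (inj₁ (x∈⁅x⁆ y))))

  x·y∈line : ∀ x y → x · y ∈ line x y
  x·y∈line x y =
    x∈p∪q⁺ {p = ⁅ x ⁆} (inj₂ (x∈p∪q⁺ {p = ⁅ y ⁆} (inj₂ (x∈⁅x⁆ (x · y)))))

  ∣line∣≡3 : ∀ {x y} → x ≢ y → ∣ line x y ∣ ≡ 3
  ∣line∣≡3 {x} {y} x≢y =
    trans (∣⁅x⁆∪p∣ x _ x∉)
          (cong suc (trans (∣⁅x⁆∪p∣ y _ y∉) (cong suc (∣⁅x⁆∣≡1 (x · y)))))
    where
    y∉ : y ∉ ⁅ x · y ⁆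
    y∉ y∈ = ·-≢ʳ x≢y (sym (x∈⁅y⁆⇒x≡y _ y∈))
    x∉ : x ∉ ⁅ y ⁆ ∪ ⁅ x · y ⁆
    x∉ x∈ with x∈p∪q⁻ ⁅ y ⁆ _ x∈
    ... | inj₁ x∈y = x≢y (x∈⁅y⁆⇒x≡y y x∈y)
    ... | inj₂ x∈xy = ·-≢ˡ x≢y (sym (x∈⁅y⁆⇒x≡y _ x∈xy))

  ∪-swap : ∀ (p q r : Subset v) → p ∪ q ∪ r ≡ q ∪ p ∪ r
  ∪-swap p q r = trans (sym (∪-assoc p q r)) (trans (cong (_∪ r) (∪-comm p q)) (∪-assoc q p r))

  line-comm : ∀ x y → line x y ≡ line y x
  line-comm x y =
    trans (∪-swap ⁅ x ⁆ ⁅ y ⁆ ⁅ x · y ⁆) (cong (λ z → ⁅ y ⁆ ∪ ⁅ x ⁆ ∪ ⁅ z ⁆) (·-comm x y))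

  line-· : ∀ x y → line x (x · y) ≡ line x y
  line-· x y = cong (⁅ x ⁆ ∪_)
    (trans (cong (λ z → ⁅ x · y ⁆ ∪ ⁅ z ⁆) (·-involutive x y)) (∪-comm ⁅ x · y ⁆ ⁅ y ⁆))

  line-through : ∀ {x y u w} → u ≢ w → u ∈ line x y → w ∈ line x y → line u w ≡ line x y
  line-through {x} {y} u≢w u∈ w∈ with ∈-line⁻ u∈ | ∈-line⁻ w∈
  ... | inj₁ refl | inj₁ refl = ⊥-elim (u≢w refl)
  ... | inj₁ refl | inj₂ (inj₁ refl) = refl
  ... | inj₁ refl | inj₂ (inj₂ refl) = line-· x y
  ... | inj₂ (inj₁ refl) | inj₁ refl = line-comm y x
  ... | inj₂ (inj₁ refl) | inj₂ (inj₁ refl) = ⊥-elim (u≢w refl)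
  ... | inj₂ (inj₁ refl) | inj₂ (inj₂ refl) =
    trans (cong (line y) (·-comm x y)) (trans (line-· y x) (line-comm y x))
  ... | inj₂ (inj₂ refl) | inj₁ refl = trans (line-comm (x · y) x) (line-· x y)
  ... | inj₂ (inj₂ refl) | inj₂ (inj₁ refl) =
    trans (line-comm (x · y) y) (trans (cong (line y) (·-comm x y)) (trans (line-· y x) (line-comm y x)))
  ... | inj₂ (inj₂ refl) | inj₂ (inj₂ refl) = ⊥-elim (u≢w refl)

  IsLine : Subset v → Set
  IsLine B = ∃₂ λ x y → x ≢ y × B ≡ line x y

  steinerTripleSystem : STS v
  steinerTripleSystem = record
    { Block     = IsLine
    ; block-3   = λ { _ (_ , _ , x≢y , refl) → ∣line∣≡3 x≢y }
    ; pair-cov  = λ x y x≢y → line x y , (x , y , x≢y , refl) , x∈line x y , y∈line x y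
    ; pair-uniq = λ { x y x≢y _ _ (_ , _ , _ , refl) x∈B y∈B (_ , _ , _ , refl) x∈B′ y∈B′ →
                      trans (sym (line-through x≢y x∈B y∈B)) (line-through x≢y x∈B′ y∈B′) }
    }

  coloring⇒proper : ∀ {k} {ψ : Fin v → Fin k} → IsColoring steinerTripleSystem k ψ → Proper _·_ ψ
  coloring⇒proper {ψ = ψ} col x y x≢y ψx≡ψy ψxy≡ψx = col (line x y) (x , y , x≢y , refl) (ψ x , mono)
    where
    mono : ∀ z → z ∈ line x y → ψ z ≡ ψ x
    mono z z∈ with ∈-line⁻ z∈
    ... | inj₁ refl = refl
    ... | inj₂ (inj₁ refl) = sym ψx≡ψy
    ... | inj₂ (inj₂ refl) = ψxy≡ψx

  proper⇒coloring : ∀ {k} {ψ : Fin v → Fin k} → Proper _·_ ψ → IsColoring steinerTripleSystem k ψ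
  proper⇒coloring proper _ (x , y , x≢y , refl) (c , mono) =
    proper x y x≢y (trans (mono x (x∈line x y)) (sym (mono y (y∈line x y))))
                   (trans (mono _ (x·y∈line x y)) (sym (mono x (x∈line x y))))

  recolor : ∀ {k} → (Fin v → Fin k) → Fin v → Fin k → Fin v → Fin k
  recolor ψ y c x = if does (x ≟ y) then c else ψ x

  recolor-≡ : ∀ {k} (ψ : Fin v → Fin k) y c → recolor ψ y c y ≡ c
  recolor-≡ ψ y c with y ≟ y
  ... | yes _ = refl
  ... | no y≢y = ⊥-elim (y≢y refl)

  recolor-≢ : ∀ {k} (ψ : Fin v → Fin k) {y} c {x} → x ≢ y → recolor ψ y c x ≡ ψ x
  recolor-≢ ψ {y} c {x} x≢y with x ≟ y
  ... | yes x≡y = ⊥-elim (x≢y x≡y)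
  ... | no _ = refl

  another-point : ∀ {x w} → x ≢ w → ∀ y → ∃ λ u → u ∈ line x w × u ≢ y
  another-point {x} {w} x≢w y with x ≟ y
  ... | yes refl = w , y∈line x w , λ w≡x → x≢w (sym w≡x)
  ... | no x≢y = x , x∈line x w , x≢y

  recolor-coloring : ∀ {k} {ψ : Fin v → Fin k} {y c} → IsColoring steinerTripleSystem k ψ →
                     (∀ w → w ≢ y → ψ w ≡ c → ψ (y · w) ≢ c) →
                     IsColoring steinerTripleSystem k (recolor ψ y c)
  recolor-coloring {ψ = ψ} {y} {c} coloring admissible B B-line@(x , w , x≢w , refl) (c′ , mono) with y ∈? B
  ... | no y∉B =
    coloring B B-line (c′ , λ z z∈B → trans (sym (recolor-≢ ψ c (λ { refl → y∉B z∈B }))) (mono z z∈B))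
  ... | yes y∈B with another-point x≢w y
  ...   | u , u∈B , u≢y = admissible u u≢y (off-y u≢y u∈B) (off-y (·-≢ˡ y≢u) yu∈B)
    where
    y≢u = λ y≡u → u≢y (sym y≡u)
    yu∈B : y · u ∈ B
    yu∈B = subst (y · u ∈_) (line-through y≢u y∈B u∈B) (x·y∈line y u)
    off-y : ∀ {z} → z ≢ y → z ∈ B → ψ z ≡ c
    off-y {z} z≢y z∈B =
      trans (sym (recolor-≢ ψ c z≢y)) (trans (mono z z∈B) (trans (sym (mono y y∈B)) (recolor-≡ ψ y c)))

  module Counting (ψ : Fin v → Fin 2) (proper : Proper _·_ ψ) where

    N : Fin 2 → ℕ
    N c = ∑[ u < v ] 𝟙 (ψ u ≟ c)

    ∑-· : ∀ x (f : Fin v → ℕ) → sum (λ u → f (x · u)) ≡ sum f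
    ∑-· x f = sym (∑-permute f (permutation (x ·_) (x ·_) (·-involutive x) (·-involutive x)))

    N-partition : ∀ {c d} → c ≢ d → N c + N d ≡ v
    N-partition {c} {d} c≢d = begin
      N c + N d
        ≡⟨ ∑-distrib-+ (λ u → 𝟙 (ψ u ≟ c)) _ ⟨
      ∑[ u < v ] (𝟙 (ψ u ≟ c) + 𝟙 (ψ u ≟ d))
        ≡⟨ sum-cong-≗ (λ u → 𝟙-fin2-partition c≢d (ψ u)) ⟩
      ∑[ u < v ] 1
        ≡⟨ ∑-const-1 v ⟩
      v ∎
      where open ≡-Reasoning

    private
      𝟙-partner : ∀ {x u d} → u ≢ x → ψ x ≢ d → 𝟙 (ψ u ≟ ψ x) ≤ 𝟙 (ψ (x · u) ≟ d)
      𝟙-partner {x} {u} {d} u≢x ψx≢d = 𝟙-≤ (ψ u ≟ ψ x) (ψ (x · u) ≟ d)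
        λ ψu≡ψx → ≢-≢⇒≡ (proper x u (λ x≡u → u≢x (sym x≡u)) (sym ψu≡ψx))
                        (λ d≡ψx → ψx≢d (sym d≡ψx))

    -- x · _ is an involution taking every point u ≢ x of color ψ x to one of the other color;
    -- if the line through x and w has colors ψ x, ψ w, ψ w, it also pairs w with x · w.
    N-≤ : ∀ {x y} → ψ x ≢ ψ y → N (ψ x) ≤ suc (N (ψ y))
    N-≤ {x} {y} ψx≢ψy = begin
      N (ψ x)
        ≤⟨ ∑-mono-≤ pointwise ⟩
      ∑[ u < v ] (𝟙 (u ≟ x) + 𝟙 (ψ (x · u) ≟ ψ y))
        ≡⟨ ∑-distrib-+ (λ u → 𝟙 (u ≟ x)) _ ⟩
      ∑[ u < v ] 𝟙 (u ≟ x) + ∑[ u < v ] 𝟙 (ψ (x · u) ≟ ψ y)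
        ≡⟨ cong₂ _+_ (∑-singleton x) (∑-· x (λ u → 𝟙 (ψ u ≟ ψ y))) ⟩
      suc (N (ψ y)) ∎
      where
      open ≤-Reasoning
      pointwise : ∀ u → 𝟙 (ψ u ≟ ψ x) ≤ 𝟙 (u ≟ x) + 𝟙 (ψ (x · u) ≟ ψ y)
      pointwise u with u ≟ x
      ... | yes refl = ≤-trans (𝟙≤1 (ψ u ≟ ψ u)) (s≤s z≤n)
      ... | no u≢x = 𝟙-partner u≢x ψx≢ψy

    private
      N-<-line : ∀ {x w} → x ≢ w → ψ w ≡ ψ (x · w) → N (ψ x) < N (ψ w)
      N-<-line {x} {w} x≢w ψw≡ψxw = ≤-pred (begin
        suc (suc (N (ψ x)))
          ≡⟨ cong₂ (λ a b → a + b + N (ψ x)) (∑-singleton w) (∑-singleton (x · w)) ⟨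
        ∑[ u < v ] 𝟙 (u ≟ w) + ∑[ u < v ] 𝟙 (u ≟ x · w) + N (ψ x)
          ≡⟨ cong (_+ N (ψ x)) (∑-distrib-+ (λ u → 𝟙 (u ≟ w)) _) ⟨
        ∑[ u < v ] (𝟙 (u ≟ w) + 𝟙 (u ≟ x · w)) + N (ψ x)
          ≡⟨ ∑-distrib-+ (λ u → 𝟙 (u ≟ w) + 𝟙 (u ≟ x · w)) _ ⟨
        ∑[ u < v ] (𝟙 (u ≟ w) + 𝟙 (u ≟ x · w) + 𝟙 (ψ u ≟ ψ x))
          ≤⟨ ∑-mono-≤ pointwise ⟩
        ∑[ u < v ] (𝟙 (u ≟ x) + 𝟙 (ψ (x · u) ≟ ψ w))
          ≡⟨ ∑-distrib-+ (λ u → 𝟙 (u ≟ x)) _ ⟩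
        ∑[ u < v ] 𝟙 (u ≟ x) + ∑[ u < v ] 𝟙 (ψ (x · u) ≟ ψ w)
          ≡⟨ cong₂ _+_ (∑-singleton x) (∑-· x (λ u → 𝟙 (ψ u ≟ ψ w))) ⟩
        suc (N (ψ w)) ∎)
        where
        open ≤-Reasoning
        ψx≢ψw : ψ x ≢ ψ w
        ψx≢ψw ψx≡ψw = proper x w x≢w ψx≡ψw (trans (sym ψw≡ψxw) (sym ψx≡ψw))
        pointwise : ∀ u → 𝟙 (u ≟ w) + 𝟙 (u ≟ x · w) + 𝟙 (ψ u ≟ ψ x)
                        ≤ 𝟙 (u ≟ x) + 𝟙 (ψ (x · u) ≟ ψ w)
        pointwise u with u ≟ x | u ≟ w | u ≟ x · w
        ... | yes refl | yes x≡w | _ = ⊥-elim (x≢w x≡w)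
        ... | yes refl | no _ | yes x≡xw = ⊥-elim (·-≢ˡ x≢w (sym x≡xw))
        ... | yes refl | no _ | no _ = ≤-trans (𝟙≤1 (ψ u ≟ ψ u)) (s≤s z≤n)
        ... | no _ | yes refl | yes w≡xw = ⊥-elim (·-≢ʳ x≢w (sym w≡xw))
        ... | no _ | yes refl | no _ =
          ≤-reflexive (trans (cong suc (𝟙-no (ψ w ≟ ψ x) (λ ψw≡ψx → ψx≢ψw (sym ψw≡ψx))))
                             (sym (𝟙-yes (ψ (x · w) ≟ ψ w) (sym ψw≡ψxw))))
        ... | no _ | no _ | yes refl =
          ≤-reflexive (trans (cong suc (𝟙-no (ψ (x · w) ≟ ψ x)
                                                (λ ψxw≡ψx → ψx≢ψw (trans (sym ψxw≡ψx) (sym ψw≡ψxw)))))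
                             (sym (𝟙-yes (ψ (x · (x · w)) ≟ ψ w) (cong ψ (·-involutive x w)))))
        ... | no u≢x | no _ | no _ = 𝟙-partner u≢x ψx≢ψw

    N-< : ∀ {y z} → y ≢ z → ψ y ≡ ψ z → N (ψ (y · z)) < N (ψ y)
    N-< {y} {z} y≢z ψy≡ψz = N-<-line (·-≢ˡ y≢z) (trans ψy≡ψz (cong ψ (sym yz·y≡z)))
      where
      yz·y≡z : (y · z) · y ≡ z
      yz·y≡z = trans (·-comm (y · z) y) (·-involutive y z)

    another-of-color : ∀ {x} → 2 ≤ N (ψ x) → ∃ λ p → p ≢ x × ψ p ≡ ψ x
    another-of-color {x} 2≤N with any? (λ p → ¬? (p ≟ x) ×-dec (ψ p ≟ ψ x))
    ... | yes found = found
    ... | no ∄p = ⊥-elim (≤⇒≯ (≤-trans (∑-mono-≤ pointwise) (≤-reflexive (∑-singleton x))) 2≤N)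
      where
      pointwise : ∀ u → 𝟙 (ψ u ≟ ψ x) ≤ 𝟙 (u ≟ x)
      pointwise u = 𝟙-≤ (ψ u ≟ ψ x) (u ≟ x)
        λ ψu≡ψx → decidable-stable (u ≟ x) (λ u≢x → ∄p (u , u≢x , ψu≡ψx))

    no-monochromatic-pair : 5 ≤ v → ∀ {y z} → y ≢ z → ψ y ≡ ψ z → ⊥
    no-monochromatic-pair 5≤v {y} {z} y≢z ψy≡ψz =
      <-asym N[ψx]<N[ψy] (N[ψy]<N[ψx] (another-of-color 2≤N[ψx]))
      where
      x = y · z
      ψx≢ψy : ψ x ≢ ψ y
      ψx≢ψy = proper y z y≢z ψy≡ψz
      N[ψx]<N[ψy] : N (ψ x) < N (ψ y)
      N[ψx]<N[ψy] = N-< y≢z ψy≡ψz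
      2≤N[ψx] : 2 ≤ N (ψ x)
      2≤N[ψx] = 5≤m+n⇒n≤1+m⇒2≤m (subst (5 ≤_) (sym (N-partition ψx≢ψy)) 5≤v)
                                   (N-≤ (λ ψy≡ψx → ψx≢ψy (sym ψy≡ψx)))
      N[ψy]<N[ψx] : (∃ λ p → p ≢ x × ψ p ≡ ψ x) → N (ψ y) < N (ψ x)
      N[ψy]<N[ψx] (p , p≢x , ψp≡ψx) = subst (λ c → N c < N (ψ x)) ψxp≡ψy (N-< x≢p (sym ψp≡ψx))
        where
        x≢p = λ x≡p → p≢x (sym x≡p)
        ψxp≡ψy : ψ (x · p) ≡ ψ y
        ψxp≡ψy = ≢-≢⇒≡ (proper x p x≢p (sym ψp≡ψx)) (λ ψy≡ψx → ψx≢ψy (sym ψy≡ψx))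

  ¬proper-2-coloring : 5 ≤ v → (ψ : Fin v → Fin 2) → ¬ Proper _·_ ψ
  ¬proper-2-coloring 5≤v ψ proper with pigeonhole (≤-trans (s≤s (s≤s (s≤s z≤n))) 5≤v) ψ
  ... | _ , _ , y<z , ψy≡ψz = Counting.no-monochromatic-pair ψ proper 5≤v (<⇒≢ y<z) ψy≡ψz

-- Half-idempotent commutative quasigroups

data Half (n : ℕ) : Set where
  lo hi : Fin n → Half n

index : ∀ {n} → Half n → Fin n
index (lo x) = x
index (hi x) = x

_≟ʰ_ : ∀ {n} → DecidableEquality (Half n)
lo x ≟ʰ lo y with x ≟ y
... | yes refl = yes refl
... | no x≢y = no λ { refl → x≢y refl }
hi x ≟ʰ hi y with x ≟ y
... | yes refl = yes refl
... | no x≢y = no λ { refl → x≢y refl }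
lo _ ≟ʰ hi _ = no λ ()
hi _ ≟ʰ lo _ = no λ ()

-- lo x and hi x stand for x and x + n; ∘-diag is half-idempotence.
record HalfIdempotentCommutativeQuasigroup (n : ℕ) : Set where
  infixl 7 _∘_ _\\_
  field
    _∘_    : Half n → Half n → Half n
    _\\_   : Half n → Half n → Half n
    ∘-comm : ∀ a b → a ∘ b ≡ b ∘ a
    ∘-\\   : ∀ a c → a ∘ (a \\ c) ≡ c
    \\-∘   : ∀ a b → a \\ (a ∘ b) ≡ b
    ∘-diag : ∀ a → a ∘ a ≡ lo (index a)

  ∘-cancelˡ : ∀ a {b c} → a ∘ b ≡ a ∘ c → b ≡ c
  ∘-cancelˡ a {b} {c} e = trans (sym (\\-∘ a b)) (trans (cong (a \\_) e) (\\-∘ a c))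

  ∘-≢-diag : ∀ {a b} → a ≢ b → a ∘ b ≢ lo (index a)
  ∘-≢-diag {a} a≢b e = a≢b (∘-cancelˡ a (trans (∘-diag a) (sym e)))

  \\-≢ : ∀ {a b} → b ≢ lo (index a) → a \\ b ≢ a
  \\-≢ {a} {b} b≢ e = b≢ (trans (sym (∘-\\ a b)) (trans (cong (a ∘_) e) (∘-diag a)))

double : ℕ → ℕ
double zero = zero
double (suc t) = suc (suc (double t))

double≡+ : ∀ t → double t ≡ t + t
double≡+ zero = refl
double≡+ (suc t) = cong suc (trans (cong suc (double≡+ t)) (sym (+-suc t t)))

⌊double/2⌋ : ∀ t → ⌊ double t /2⌋ ≡ t
⌊double/2⌋ zero = refl
⌊double/2⌋ (suc t) = cong suc (⌊double/2⌋ t)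

⌊1+double/2⌋ : ∀ t → ⌊ suc (double t) /2⌋ ≡ t
⌊1+double/2⌋ zero = refl
⌊1+double/2⌋ (suc t) = cong suc (⌊1+double/2⌋ t)

parity-double : ∀ t → parity (double t) ≡ 0ℙ
parity-double zero = refl
parity-double (suc t) = parity-double t

parity-1+double : ∀ t → parity (suc (double t)) ≡ 1ℙ
parity-1+double zero = refl
parity-1+double (suc t) = parity-1+double t

bit : Parity → ℕ
bit 0ℙ = 0
bit 1ℙ = 1

halving : ∀ s → s ≡ double ⌊ s /2⌋ + bit (parity s)
halving zero = refl
halving (suc zero) = refl
halving (suc (suc s)) = cong (λ t → suc (suc t)) (halving s)

⌊/2⌋-< : ∀ {s n} → s < n + n → ⌊ s /2⌋ < n
⌊/2⌋-< {zero} {suc n} _ = s≤s z≤n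
⌊/2⌋-< {suc zero} {suc n} _ = s≤s z≤n
⌊/2⌋-< {suc (suc s)} {suc n} (s≤s s<n+n) =
  s≤s (⌊/2⌋-< (≤-pred (≤-trans s<n+n (≤-reflexive (+-suc n n)))))

-- Skolem's quasigroup on ℤ₂ₙ: a ∘ b is the point whose code is val a + val b, i.e. (a + b) / 2
-- with odd sums sent to the hi half.
module Cyclic (k : ℕ) where
  n m : ℕ
  n = suc k
  m = n + n

  mod-toℕ : ∀ (x : Fin n) → toℕ x mod n ≡ x
  mod-toℕ x = toℕ-injective (trans (toℕ-fromℕ< _) (m<n⇒m%n≡m (toℕ<n x)))

  toℕ-mod : ∀ {j} → j < n → toℕ (j mod n) ≡ j
  toℕ-mod j<n = trans (toℕ-fromℕ< _) (m<n⇒m%n≡m j<n)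

  val : Half n → ℕ
  val (lo x) = toℕ x
  val (hi x) = n + toℕ x

  fromVal : ℕ → Half n
  fromVal s with s <? n
  ... | yes _ = lo (s mod n)
  ... | no _  = hi ((s ∸ n) mod n)

  val< : ∀ a → val a < m
  val< (lo x) = <-≤-trans (toℕ<n x) (m≤m+n n n)
  val< (hi x) = +-monoʳ-< n (toℕ<n x)

  fromVal-val : ∀ a → fromVal (val a) ≡ a
  fromVal-val (lo x) with toℕ x <? n
  ... | yes _ = cong lo (mod-toℕ x)
  ... | no x≮n = contradiction (toℕ<n x) x≮n
  fromVal-val (hi x) with n + toℕ x <? n
  ... | yes n+x<n = contradiction n+x<n (m+n≮m n (toℕ x))
  ... | no _ = cong hi (trans (cong (_mod n) (m+n∸m≡n n (toℕ x))) (mod-toℕ x))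

  val-fromVal : ∀ {s} → s < m → val (fromVal s) ≡ s
  val-fromVal {s} s<m with s <? n
  ... | yes s<n = toℕ-mod s<n
  ... | no s≮n = trans (cong (n +_) (toℕ-mod s∸n<n)) (m+[n∸m]≡n n≤s)
    where
    n≤s = ≮⇒≥ s≮n
    s∸n<n : s ∸ n < n
    s∸n<n = +-cancelˡ-< n (s ∸ n) n (subst (_< m) (sym (m+[n∸m]≡n n≤s)) s<m)

  code : Half n → ℕ
  code (lo x) = double (toℕ x)
  code (hi x) = suc (double (toℕ x))

  fromParity : Parity → Fin n → Half n
  fromParity 0ℙ = lo
  fromParity 1ℙ = hi

  fromCode : ℕ → Half n
  fromCode s = fromParity (parity s) (⌊ s /2⌋ mod n)

  code< : ∀ c → code c < m
  code< (lo x) = subst (_< m) (sym (double≡+ (toℕ x))) (+-mono-< (toℕ<n x) (toℕ<n x))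
  code< (hi x) = subst (λ j → suc j < m) (sym (double≡+ (toℕ x))) (+-mono-≤-< (toℕ<n x) (toℕ<n x))

  fromCode-code : ∀ c → fromCode (code c) ≡ c
  fromCode-code (lo x) =
    cong₂ fromParity (parity-double (toℕ x)) (trans (cong (_mod n) (⌊double/2⌋ (toℕ x))) (mod-toℕ x))
  fromCode-code (hi x) =
    cong₂ fromParity (parity-1+double (toℕ x)) (trans (cong (_mod n) (⌊1+double/2⌋ (toℕ x))) (mod-toℕ x))

  code-fromCode : ∀ {s} → s < m → code (fromCode s) ≡ s
  code-fromCode {s} s<m = begin
    code (fromParity (parity s) (⌊ s /2⌋ mod n))
      ≡⟨ code-fromParity (parity s) ⟩
    double (toℕ (⌊ s /2⌋ mod n)) + bit (parity s)
      ≡⟨ cong (λ t → double t + bit (parity s)) (toℕ-mod (⌊/2⌋-< s<m)) ⟩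
    double ⌊ s /2⌋ + bit (parity s)
      ≡⟨ halving s ⟨
    s ∎
    where
    open ≡-Reasoning
    code-fromParity : ∀ p {x} → code (fromParity p x) ≡ double (toℕ x) + bit p
    code-fromParity 0ℙ = sym (+-identityʳ _)
    code-fromParity 1ℙ = sym (+-comm _ 1)

  fromCode-code%m : ∀ c → fromCode (code c % m) ≡ c
  fromCode-code%m c = trans (cong fromCode (m<n⇒m%n≡m (code< c))) (fromCode-code c)

  fromVal-val%m : ∀ a → fromVal (val a % m) ≡ a
  fromVal-val%m a = trans (cong fromVal (m<n⇒m%n≡m (val< a))) (fromVal-val a)

  [x+y%m]%m≡[x+y]%m : ∀ x y → (x + y % m) % m ≡ (x + y) % m
  [x+y%m]%m≡[x+y]%m x y = begin
    (x + y % m) % m            ≡⟨ %-distribˡ-+ x (y % m) m ⟩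
    (x % m + y % m % m) % m    ≡⟨ cong (λ z → (x % m + z) % m) (m%n%n≡m%n y m) ⟩
    (x % m + y % m) % m        ≡⟨ %-distribˡ-+ x y m ⟨
    (x + y) % m                ∎
    where open ≡-Reasoning

  [x%m+y]%m≡[x+y]%m : ∀ x y → (x % m + y) % m ≡ (x + y) % m
  [x%m+y]%m≡[x+y]%m x y =
    trans (cong (_% m) (+-comm (x % m) y)) (trans ([x+y%m]%m≡[x+y]%m y x) (cong (_% m) (+-comm y x)))

  [x+y+[m∸x]]%m≡y%m : ∀ {x} y → x ≤ m → (x + y + (m ∸ x)) % m ≡ y % m
  [x+y+[m∸x]]%m≡y%m {x} y x≤m = begin
    (x + y + (m ∸ x)) % m    ≡⟨ cong (λ z → (z + (m ∸ x)) % m) (+-comm x y) ⟩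
    (y + x + (m ∸ x)) % m    ≡⟨ cong (_% m) (+-assoc y x (m ∸ x)) ⟩
    (y + (x + (m ∸ x))) % m  ≡⟨ cong (λ z → (y + z) % m) (m+[n∸m]≡n x≤m) ⟩
    (y + m) % m              ≡⟨ [m+n]%n≡m%n y m ⟩
    y % m                    ∎
    where open ≡-Reasoning

  infixl 7 _∘_ _\\_
  _∘_ : Half n → Half n → Half n
  a ∘ b = fromCode ((val a + val b) % m)

  _\\_ : Half n → Half n → Half n
  a \\ c = fromVal ((code c + (m ∸ val a)) % m)

  ∘-\\ : ∀ a c → a ∘ (a \\ c) ≡ c
  ∘-\\ a c = begin
    fromCode ((val a + val (fromVal r)) % m)
      ≡⟨ cong (λ z → fromCode ((val a + z) % m)) (val-fromVal (m%n<n (code c + (m ∸ val a)) m)) ⟩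
    fromCode ((val a + r) % m)
      ≡⟨ cong fromCode ([x+y%m]%m≡[x+y]%m (val a) _) ⟩
    fromCode ((val a + (code c + (m ∸ val a))) % m)
      ≡⟨ cong (λ z → fromCode (z % m)) (+-assoc (val a) (code c) _) ⟨
    fromCode ((val a + code c + (m ∸ val a)) % m)
      ≡⟨ cong fromCode ([x+y+[m∸x]]%m≡y%m (code c) (<⇒≤ (val< a))) ⟩
    fromCode (code c % m)
      ≡⟨ fromCode-code%m c ⟩
    c ∎
    where
    open ≡-Reasoning
    r = (code c + (m ∸ val a)) % m

  \\-∘ : ∀ a b → a \\ (a ∘ b) ≡ b
  \\-∘ a b = begin
    fromVal ((code (fromCode r) + (m ∸ val a)) % m)
      ≡⟨ cong (λ z → fromVal ((z + (m ∸ val a)) % m)) (code-fromCode (m%n<n (val a + val b) m)) ⟩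
    fromVal ((r + (m ∸ val a)) % m)
      ≡⟨ cong fromVal ([x%m+y]%m≡[x+y]%m (val a + val b) _) ⟩
    fromVal ((val a + val b + (m ∸ val a)) % m)
      ≡⟨ cong fromVal ([x+y+[m∸x]]%m≡y%m (val b) (<⇒≤ (val< a))) ⟩
    fromVal (val b % m)
      ≡⟨ fromVal-val%m b ⟩
    b ∎
    where
    open ≡-Reasoning
    r = (val a + val b) % m

  ∘-diag : ∀ a → a ∘ a ≡ lo (index a)
  ∘-diag (lo x) = trans (cong (λ z → fromCode (z % m)) (sym (double≡+ (toℕ x)))) (fromCode-code%m (lo x))
  ∘-diag (hi x) = begin
    fromCode ((n + t + (n + t)) % m)  ≡⟨ cong (λ z → fromCode (z % m)) (shuffle n t) ⟩
    fromCode ((code (lo x) + m) % m)  ≡⟨ cong fromCode ([m+n]%n≡m%n (code (lo x)) m) ⟩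
    fromCode (code (lo x) % m)        ≡⟨ fromCode-code%m (lo x) ⟩
    lo x                              ∎
    where
    open ≡-Reasoning
    t = toℕ x
    shuffle : ∀ n t → n + t + (n + t) ≡ double t + (n + n)
    shuffle n t rewrite double≡+ t = solve 2 (λ n t → n :+ t :+ (n :+ t) := t :+ t :+ (n :+ n)) refl n t
      where open +-*-Solver

  halfIdempotentCommutativeQuasigroup : HalfIdempotentCommutativeQuasigroup n
  halfIdempotentCommutativeQuasigroup = record
    { _∘_ = _∘_ ; _\\_ = _\\_
    ; ∘-comm = λ a b → cong (λ z → fromCode (z % m)) (+-comm (val a) (val b))
    ; ∘-\\ = ∘-\\ ; \\-∘ = \\-∘ ; ∘-diag = ∘-diag
    }

-- Skolem's construction

next : Fin 3 → Fin 3
next 0F = 1F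
next 1F = 2F
next 2F = 0F

next³ : ∀ i → next (next (next i)) ≡ i
next³ 0F = refl
next³ 1F = refl
next³ 2F = refl

next≢ : ∀ i → next i ≢ i
next≢ 0F ()
next≢ 1F ()
next≢ 2F ()

next²≢ : ∀ i → next (next i) ≢ i
next²≢ 0F ()
next²≢ 1F ()
next²≢ 2F ()

data Position : Fin 3 → Fin 3 → Set where
  same  : ∀ i → Position i i
  above : ∀ i → Position i (next i)
  below : ∀ i → Position (next i) i

position : ∀ i j → Position i j
position 0F 0F = same 0F
position 0F 1F = above 0F
position 0F 2F = below 2F
position 1F 0F = below 0F
position 1F 1F = same 1F
position 1F 2F = above 1F
position 2F 0F = above 2F
position 2F 1F = below 1F
position 2F 2F = same 2F

position-same : ∀ i → position i i ≡ same i
position-same 0F = refl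
position-same 1F = refl
position-same 2F = refl

position-above : ∀ i → position i (next i) ≡ above i
position-above 0F = refl
position-above 1F = refl
position-above 2F = refl

position-below : ∀ i → position (next i) i ≡ below i
position-below 0F = refl
position-below 1F = refl
position-below 2F = refl

module Skolem {n} (Q : HalfIdempotentCommutativeQuasigroup n) where
  open HalfIdempotentCommutativeQuasigroup Q

  data Point : Set where
    ∞  : Point
    pt : Half n → Fin 3 → Point

  pt-injectiveˡ : ∀ {a b i j} → pt a i ≡ pt b j → a ≡ b
  pt-injectiveˡ refl = refl

  ∞-partner : Half n → Fin 3 → Point
  ∞-partner (lo x) i = pt (hi x) (next (next i))
  ∞-partner (hi x) i = pt (lo x) (next i)

  sameLevel : Half n → Half n → Fin 3 → Point
  sameLevel a b i with a ≟ʰ b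
  ... | yes _ = pt a i
  ... | no _  = pt (a ∘ b) (next i)

  adjacentLevel : Half n → Half n → Fin 3 → Point
  adjacentLevel a b i with b ≟ʰ lo (index a)
  adjacentLevel (lo x) _ i | yes _ = pt (lo x) (next (next i))
  adjacentLevel (hi x) _ i | yes _ = ∞
  adjacentLevel a      b i | no _  = pt (a \\ b) i

  onLevels : ∀ {i j} → Half n → Half n → Position i j → Point
  onLevels a b (same i)  = sameLevel a b i
  onLevels a b (above i) = adjacentLevel a b i
  onLevels a b (below j) = adjacentLevel b a j

  -- The lines are {(lo x, 0), (lo x, 1), (lo x, 2)}, {∞, (hi x, i), (lo x, i + 1)} and
  -- {(a, i), (b, i), (a ∘ b, i + 1)} for a ≢ b.
  infixl 7 _·_
  _·_ : Point → Point → Point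
  ∞      · ∞      = ∞
  ∞      · pt a i = ∞-partner a i
  pt a i · ∞      = ∞-partner a i
  pt a i · pt b j = onLevels a b (position i j)

  ·-same : ∀ a b i → pt a i · pt b i ≡ sameLevel a b i
  ·-same a b i = cong (onLevels a b) (position-same i)

  ·-above : ∀ a b i → pt a i · pt b (next i) ≡ adjacentLevel a b i
  ·-above a b i = cong (onLevels a b) (position-above i)

  ·-below : ∀ a b i → pt a (next i) · pt b i ≡ adjacentLevel b a i
  ·-below a b i = cong (onLevels a b) (position-below i)

  ·-below² : ∀ a b i → pt a i · pt b (next (next i)) ≡ adjacentLevel b a (next (next i))
  ·-below² a b 0F = refl
  ·-below² a b 1F = refl
  ·-below² a b 2F = refl

  sameLevel-≡ : ∀ a i → sameLevel a a i ≡ pt a i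
  sameLevel-≡ a i with a ≟ʰ a
  ... | yes _ = refl
  ... | no a≢a = ⊥-elim (a≢a refl)

  sameLevel-≢ : ∀ {a b} i → a ≢ b → sameLevel a b i ≡ pt (a ∘ b) (next i)
  sameLevel-≢ {a} {b} i a≢b with a ≟ʰ b
  ... | yes a≡b = ⊥-elim (a≢b a≡b)
  ... | no _ = refl

  sameLevel-comm : ∀ a b i → sameLevel a b i ≡ sameLevel b a i
  sameLevel-comm a b i with a ≟ʰ b | b ≟ʰ a
  ... | yes refl | yes _ = refl
  ... | yes a≡b | no b≢a = ⊥-elim (b≢a (sym a≡b))
  ... | no a≢b | yes b≡a = ⊥-elim (a≢b (sym b≡a))
  ... | no _ | no _ = cong (λ c → pt c (next i)) (∘-comm a b)

  adjacentLevel-generic : ∀ {a b} i → b ≢ lo (index a) → adjacentLevel a b i ≡ pt (a \\ b) i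
  adjacentLevel-generic {lo x} {b} i b≢ with b ≟ʰ lo x
  ... | yes b≡ = ⊥-elim (b≢ b≡)
  ... | no _ = refl
  adjacentLevel-generic {hi x} {b} i b≢ with b ≟ʰ lo x
  ... | yes b≡ = ⊥-elim (b≢ b≡)
  ... | no _ = refl

  adjacentLevel-lo : ∀ x i → adjacentLevel (lo x) (lo x) i ≡ pt (lo x) (next (next i))
  adjacentLevel-lo x i with lo x ≟ʰ lo x
  ... | yes _ = refl
  ... | no ≢ = ⊥-elim (≢ refl)

  adjacentLevel-hi : ∀ x i → adjacentLevel (hi x) (lo x) i ≡ ∞
  adjacentLevel-hi x i with lo x ≟ʰ lo x
  ... | yes _ = refl
  ... | no ≢ = ⊥-elim (≢ refl)

  data AdjacentLevel : Half n → Half n → Fin 3 → Point → Set where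
    diag-lo : ∀ x i → AdjacentLevel (lo x) (lo x) i (pt (lo x) (next (next i)))
    diag-hi : ∀ x i → AdjacentLevel (hi x) (lo x) i ∞
    generic : ∀ a b i → b ≢ lo (index a) → AdjacentLevel a b i (pt (a \\ b) i)

  adjacentLevel-view : ∀ a b i → AdjacentLevel a b i (adjacentLevel a b i)
  adjacentLevel-view a b i with b ≟ʰ lo (index a)
  adjacentLevel-view (lo x) _ i | yes refl = diag-lo x i
  adjacentLevel-view (hi x) _ i | yes refl = diag-hi x i
  adjacentLevel-view (lo x) b i | no b≢ = generic (lo x) b i b≢
  adjacentLevel-view (hi x) b i | no b≢ = generic (hi x) b i b≢

  ·-idem : ∀ p → p · p ≡ p
  ·-idem ∞ = refl
  ·-idem (pt a i) = trans (·-same a a i) (sameLevel-≡ a i)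

  ·-comm : ∀ p q → p · q ≡ q · p
  ·-comm ∞ ∞ = refl
  ·-comm ∞ (pt _ _) = refl
  ·-comm (pt _ _) ∞ = refl
  ·-comm (pt a i) (pt b j) with position i j
  ... | same i = trans (sameLevel-comm a b i) (sym (·-same b a i))
  ... | above i = sym (·-below b a i)
  ... | below j = sym (·-above b a j)

  private
    involutive-same : ∀ a b i → pt a i · sameLevel a b i ≡ pt b i
    involutive-same a b i with a ≟ʰ b
    ... | yes refl = ·-idem (pt a i)
    ... | no a≢b = begin
      pt a i · pt (a ∘ b) (next i)   ≡⟨ ·-above a (a ∘ b) i ⟩
      adjacentLevel a (a ∘ b) i      ≡⟨ adjacentLevel-generic i (∘-≢-diag a≢b) ⟩
      pt (a \\ (a ∘ b)) i            ≡⟨ cong (λ c → pt c i) (\\-∘ a b) ⟩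
      pt b i                         ∎
      where open ≡-Reasoning

    involutive-above : ∀ a b i → pt a i · adjacentLevel a b i ≡ pt b (next i)
    involutive-above a b i with adjacentLevel a b i | adjacentLevel-view a b i
    ... | _ | diag-lo x i = begin
      pt (lo x) i · pt (lo x) (next (next i))     ≡⟨ ·-below² (lo x) (lo x) i ⟩
      adjacentLevel (lo x) (lo x) (next (next i)) ≡⟨ adjacentLevel-lo x (next (next i)) ⟩
      pt (lo x) (next (next (next (next i))))     ≡⟨ cong (pt (lo x) ∘′ next) (next³ i) ⟩
      pt (lo x) (next i)                          ∎
      where open ≡-Reasoning
    ... | _ | diag-hi x i = refl
    ... | _ | generic a b i b≢ = begin
      pt a i · pt (a \\ b) i          ≡⟨ ·-same a (a \\ b) i ⟩
      sameLevel a (a \\ b) i          ≡⟨ sameLevel-≢ i (λ a≡a\\b → \\-≢ b≢ (sym a≡a\\b)) ⟩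
      pt (a ∘ (a \\ b)) (next i)      ≡⟨ cong (λ c → pt c (next i)) (∘-\\ a b) ⟩
      pt b (next i)                   ∎
      where open ≡-Reasoning

    involutive-below : ∀ a b j → pt a (next j) · adjacentLevel b a j ≡ pt b j
    involutive-below a b j with adjacentLevel b a j | adjacentLevel-view b a j
    ... | _ | diag-lo x j = begin
      pt (lo x) (next j) · pt (lo x) (next (next j))  ≡⟨ ·-above (lo x) (lo x) (next j) ⟩
      adjacentLevel (lo x) (lo x) (next j)            ≡⟨ adjacentLevel-lo x (next j) ⟩
      pt (lo x) (next (next (next j)))                ≡⟨ cong (pt (lo x)) (next³ j) ⟩
      pt (lo x) j                                     ∎
      where open ≡-Reasoning
    ... | _ | diag-hi x j = cong (pt (hi x)) (next³ j)
    ... | _ | generic b a j a≢ = begin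
      pt a (next j) · pt s j    ≡⟨ ·-below a s j ⟩
      adjacentLevel s a j       ≡⟨ adjacentLevel-generic j a≢diag ⟩
      pt (s \\ a) j             ≡⟨ cong (λ c → pt (s \\ c) j) (sym s∘b≡a) ⟩
      pt (s \\ (s ∘ b)) j       ≡⟨ cong (λ c → pt c j) (\\-∘ s b) ⟩
      pt b j                    ∎
      where
      open ≡-Reasoning
      s = b \\ a
      s∘b≡a : s ∘ b ≡ a
      s∘b≡a = trans (∘-comm s b) (∘-\\ b a)
      a≢diag : a ≢ lo (index s)
      a≢diag a≡ = a≢ (trans a≡ (cong (λ c → lo (index c)) (sym b≡s)))
        where
        b≡s : b ≡ s
        b≡s = ∘-cancelˡ s (trans s∘b≡a (trans a≡ (sym (∘-diag s))))

  ·-involutive : ∀ p q → p · (p · q) ≡ q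
  ·-involutive ∞ ∞ = refl
  ·-involutive ∞ (pt (lo x) i) = cong (pt (lo x)) (next³ i)
  ·-involutive ∞ (pt (hi x) i) = cong (pt (hi x)) (next³ i)
  ·-involutive (pt (lo x) i) ∞ = trans (·-below² (lo x) (hi x) i) (adjacentLevel-hi x (next (next i)))
  ·-involutive (pt (hi x) i) ∞ = trans (·-above (hi x) (lo x) i) (adjacentLevel-hi x i)
  ·-involutive (pt a i) (pt b j) with position i j
  ... | same i = involutive-same a b i
  ... | above i = involutive-above a b i
  ... | below j = involutive-below a b j

  φ : Point → Fin 3
  φ ∞ = 0F
  φ (pt _ i) = i

  φ-∞-partner : ∀ a i → φ (∞-partner a i) ≢ i
  φ-∞-partner (lo _) i = next²≢ i
  φ-∞-partner (hi _) i = next≢ i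

  φ-proper : Proper _·_ φ
  φ-proper ∞ ∞ p≢q _ = ⊥-elim (p≢q refl)
  φ-proper ∞ (pt a .0F) _ refl = φ-∞-partner a 0F
  φ-proper (pt a i) ∞ _ _ = φ-∞-partner a i
  φ-proper (pt a i) (pt b .i) p≢q refl
    rewrite ·-same a b i | sameLevel-≢ i (λ a≡b → p≢q (cong (λ c → pt c i) a≡b)) = next≢ i

  isFree : Point → Bool
  isFree ∞ = true
  isFree (pt _ 0F) = true
  isFree (pt _ 1F) = true
  isFree (pt (lo _) 2F) = true
  isFree (pt (hi _) 2F) = false

  φ-adjacentLevel : ∀ a b i → isFree (pt a i) ≡ true → φ (adjacentLevel a b i) ≢ next i
  φ-adjacentLevel a b i free with adjacentLevel a b i | adjacentLevel-view a b i
  ... | _ | diag-lo x i = next≢ (next i)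
  ... | _ | diag-hi x 0F = λ ()
  ... | _ | diag-hi x 1F = λ ()
  ... | _ | diag-hi x 2F = contradiction free λ ()
  ... | _ | generic a b i _ = λ i≡next → next≢ i (sym i≡next)

  next-color-admissible : ∀ p → isFree p ≡ true →
                          ∀ w → w ≢ p → φ w ≡ next (φ p) → φ (p · w) ≢ next (φ p)
  next-color-admissible ∞ _ ∞ w≢p _ = ⊥-elim (w≢p refl)
  next-color-admissible ∞ _ (pt (lo _) .1F) _ refl = λ ()
  next-color-admissible ∞ _ (pt (hi _) .1F) _ refl = λ ()
  next-color-admissible (pt (lo _) 2F) _ ∞ _ _ = λ ()
  next-color-admissible (pt (hi _) 2F) () ∞ _ _
  next-color-admissible (pt a i) free (pt b .(next i)) _ refl rewrite ·-above a b i =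
    φ-adjacentLevel a b i free

  φ-determined-by-free : ∀ (ψ : Point → Fin 3) → Proper _·_ ψ →
                         (∀ p → isFree p ≡ true → ψ p ≡ φ p) → ∀ p → ψ p ≡ φ p
  φ-determined-by-free ψ _ agree ∞ = agree ∞ refl
  φ-determined-by-free ψ _ agree (pt a 0F) = agree (pt a 0F) refl
  φ-determined-by-free ψ _ agree (pt a 1F) = agree (pt a 1F) refl
  φ-determined-by-free ψ _ agree (pt (lo x) 2F) = agree (pt (lo x) 2F) refl
  φ-determined-by-free ψ proper agree (pt (hi x) 2F) = fin3 (ψ (pt (hi x) 2F)) ≢0 ≢1
    where
    fin3 : ∀ c → c ≢ 0F → c ≢ 1F → c ≡ 2F
    fin3 0F c≢0 _ = ⊥-elim (c≢0 refl)
    fin3 1F _ c≢1 = ⊥-elim (c≢1 refl)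
    fin3 2F _ _ = refl
    ≢0 : ψ (pt (hi x) 2F) ≢ 0F
    ≢0 ψ≡0 = proper ∞ (pt (lo x) 0F) (λ ()) (trans (agree ∞ refl) (sym (agree (pt (lo x) 0F) refl)))
                    (trans ψ≡0 (sym (agree ∞ refl)))
    a = hi x
    b = a \\ a
    a≢b : a ≢ b
    a≢b a≡b = lo≢hi (trans (sym (∘-diag a)) (trans (cong (a ∘_) a≡b) (∘-\\ a a)))
      where
      lo≢hi : lo x ≢ hi x
      lo≢hi ()
    ab≡a2 : pt a 1F · pt b 1F ≡ pt a 2F
    ab≡a2 = trans (·-same a b 1F) (trans (sameLevel-≢ 1F a≢b) (cong (λ c → pt c 2F) (∘-\\ a a)))
    ≢1 : ψ (pt (hi x) 2F) ≢ 1F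
    ≢1 ψ≡1 = proper (pt a 1F) (pt b 1F) (λ e → a≢b (pt-injectiveˡ e))
                    (trans (agree (pt a 1F) refl) (sym (agree (pt b 1F) refl)))
                    (trans (cong ψ ab≡a2) (trans ψ≡1 (sym (agree (pt a 1F) refl))))

-- The Skolem triple system on Fin (6n + 1)

module SkolemTripleSystem (k : ℕ) where
  n : ℕ
  n = suc k

  open Skolem (Cyclic.halfIdempotentCommutativeQuasigroup k)

  -- Layer 0 holds the forced points, so S is n absent points followed by 5n + 1 present ones.
  layer : Half n → Fin 3 → Fin 6
  layer (hi _) 2F = 0F
  layer (lo _) 0F = 1F
  layer (lo _) 1F = 2F
  layer (lo _) 2F = 3F
  layer (hi _) 0F = 4F
  layer (hi _) 1F = 5F

  fromLayer : Fin 6 × Fin n → Point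
  fromLayer (0F , x) = pt (hi x) 2F
  fromLayer (1F , x) = pt (lo x) 0F
  fromLayer (2F , x) = pt (lo x) 1F
  fromLayer (3F , x) = pt (lo x) 2F
  fromLayer (4F , x) = pt (hi x) 0F
  fromLayer (5F , x) = pt (hi x) 1F

  fromLayer-layer : ∀ a i → fromLayer (layer a i , index a) ≡ pt a i
  fromLayer-layer (lo _) 0F = refl
  fromLayer-layer (lo _) 1F = refl
  fromLayer-layer (lo _) 2F = refl
  fromLayer-layer (hi _) 0F = refl
  fromLayer-layer (hi _) 1F = refl
  fromLayer-layer (hi _) 2F = refl

  V : ℕ
  V = 6 * n + 1

  encode : Point → Fin V
  encode ∞ = (6 * n) ↑ʳ 0F
  encode (pt a i) = combine (layer a i) (index a) ↑ˡ 1

  decode : Fin V → Point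
  decode j with splitAt (6 * n) j
  ... | inj₁ j′ = fromLayer (remQuot n j′)
  ... | inj₂ _ = ∞

  decode-encode : ∀ p → decode (encode p) ≡ p
  decode-encode ∞ rewrite splitAt-↑ʳ (6 * n) 1 0F = refl
  decode-encode (pt a i)
    rewrite splitAt-↑ˡ (6 * n) (combine (layer a i) (index a)) 1 | remQuot-combine (layer a i) (index a) =
    fromLayer-layer a i

  encode-fromLayer : ∀ g x → encode (fromLayer (g , x)) ≡ combine g x ↑ˡ 1
  encode-fromLayer 0F x = refl
  encode-fromLayer 1F x = refl
  encode-fromLayer 2F x = refl
  encode-fromLayer 3F x = refl
  encode-fromLayer 4F x = refl
  encode-fromLayer 5F x = refl

  encode-decode : ∀ j → encode (decode j) ≡ j
  encode-decode j with splitAt (6 * n) j in eq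
  ... | inj₁ j′ =
    trans (encode-fromLayer g x) (trans (cong (_↑ˡ 1) (combine-remQuot {6} n j′)) (splitAt⁻¹-↑ˡ eq))
    where
    g = proj₁ (remQuot {6} n j′)
    x = proj₂ (remQuot {6} n j′)
  ... | inj₂ 0F = splitAt⁻¹-↑ʳ eq

  encode-injective : ∀ {p q} → encode p ≡ encode q → p ≡ q
  encode-injective {p} {q} e = trans (sym (decode-encode p)) (trans (cong decode e) (decode-encode q))

  decode-injective : ∀ {x y} → decode x ≡ decode y → x ≡ y
  decode-injective {x} {y} e = trans (sym (encode-decode x)) (trans (cong encode e) (encode-decode y))

  infixl 7 _⋆_
  _⋆_ : Fin V → Fin V → Fin V
  x ⋆ y = encode (decode x · decode y)

  decode-⋆ : ∀ x y → decode (x ⋆ y) ≡ decode x · decode y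
  decode-⋆ x y = decode-encode (decode x · decode y)

  ⋆-idem : ∀ x → x ⋆ x ≡ x
  ⋆-idem x = trans (cong encode (·-idem (decode x))) (encode-decode x)

  ⋆-comm : ∀ x y → x ⋆ y ≡ y ⋆ x
  ⋆-comm x y = cong encode (·-comm (decode x) (decode y))

  ⋆-involutive : ∀ x y → x ⋆ (x ⋆ y) ≡ y
  ⋆-involutive x y = trans (cong (λ p → encode (decode x · p)) (decode-⋆ x y))
                           (trans (cong encode (·-involutive (decode x) (decode y))) (encode-decode y))

  open SteinerQuasigroup _⋆_ ⋆-idem ⋆-comm ⋆-involutive public

  χ : Fin V → Fin 3
  χ x = φ (decode x)

  χ-proper : Proper _⋆_ χ
  χ-proper x y x≢y χx≡χy rewrite decode-⋆ x y =
    φ-proper (decode x) (decode y) (λ e → x≢y (decode-injective e)) χx≡χy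

  χ-coloring : IsColoring steinerTripleSystem 3 χ
  χ-coloring = proper⇒coloring χ-proper

  proper-encode : ∀ {c} {ψ : Fin V → Fin c} → Proper _⋆_ ψ → Proper _·_ (ψ ∘′ encode)
  proper-encode {ψ = ψ} proper p q p≢q ψp≡ψq ψpq≡ψp =
    proper (encode p) (encode q) (λ e → p≢q (encode-injective e)) ψp≡ψq
      (trans (cong (ψ ∘′ encode) (cong₂ _·_ (decode-encode p) (decode-encode q))) ψpq≡ψp)

  S : Subset V
  S = (∅ {n} ++ full {5 * n}) ++ full {1}

  free-layer : ∀ (g : Fin 5) (x : Fin n) → lookup (∅ {n} ++ full {5 * n}) (combine (suc g) x) ≡ inside
  free-layer g x = trans (lookup-++ʳ (∅ {n}) full (combine g x)) (lookup-replicate (combine g x) inside)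

  lookup-layer : ∀ a i → lookup (∅ {n} ++ full {5 * n}) (combine (layer a i) (index a)) ≡ isFree (pt a i)
  lookup-layer (hi x) 2F = trans (lookup-++ˡ ∅ full x) (lookup-replicate x outside)
  lookup-layer (lo x) 0F = free-layer 0F x
  lookup-layer (lo x) 1F = free-layer 1F x
  lookup-layer (lo x) 2F = free-layer 2F x
  lookup-layer (hi x) 0F = free-layer 3F x
  lookup-layer (hi x) 1F = free-layer 4F x

  lookup-S : ∀ p → lookup S (encode p) ≡ isFree p
  lookup-S ∞ = lookup-++ʳ (∅ {n} ++ full {5 * n}) full 0F
  lookup-S (pt a i) =
    trans (lookup-++ˡ (∅ {n} ++ full {5 * n}) full (combine (layer a i) (index a))) (lookup-layer a i)

  encode-∈S : ∀ {p} → isFree p ≡ true → encode p ∈ S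
  encode-∈S {p} free = lookup⇒[]= (encode p) S (trans (lookup-S p) free)

  ∈S⇒isFree : ∀ {x} → x ∈ S → isFree (decode x) ≡ true
  ∈S⇒isFree {x} x∈S =
    trans (sym (lookup-S (decode x))) (trans (cong (lookup S) (encode-decode x)) ([]=⇒lookup x∈S))

  ∣S∣ : ∣ S ∣ ≡ 5 * n + 1
  ∣S∣ = trans (∣p++q∣ (∅ {n} ++ full {5 * n}) full)
              (cong (_+ 1) (trans (∣p++q∣ (∅ {n}) (full {5 * n}))
                                  (cong₂ _+_ (∣⊥∣≡0 n) (∣⊤∣≡n (5 * n)))))

  S-defining : IsDefiningSet steinerTripleSystem χ S
  S-defining ψ coloring agree x =
    trans (cong ψ (sym (encode-decode x)))
          (φ-determined-by-free (ψ ∘′ encode) (proper-encode (coloring⇒proper coloring)) agree-free (decode x))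
    where
    agree-free : ∀ p → isFree p ≡ true → ψ (encode p) ≡ φ p
    agree-free p free = trans (agree (encode p) (encode-∈S free)) (cong φ (decode-encode p))

  S-minimal : IsMinimalDefiningSet steinerTripleSystem χ S
  S-minimal = minimal-if-recolorable steinerTripleSystem S-defining λ y y∈S →
    recolor χ y (next (χ y)) ,
    recolor-coloring χ-coloring (admissible y∈S) ,
    (λ x x≢y → recolor-≢ χ (next (χ y)) x≢y) ,
    (λ e → next≢ (χ y) (trans (sym (recolor-≡ χ y (next (χ y)))) e))
    where
    admissible : ∀ {y} → y ∈ S → ∀ w → w ≢ y → χ w ≡ next (χ y) → χ (y ⋆ w) ≢ next (χ y)
    admissible {y} y∈S w w≢y χw≡c rewrite decode-⋆ y w =
      next-color-admissible (decode y) (∈S⇒isFree y∈S) (decode w) (λ e → w≢y (decode-injective e)) χw≡c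

  5≤V : 5 ≤ V
  5≤V = ≤-trans (s≤s (s≤s (s≤s (s≤s (s≤s z≤n))))) (+-monoˡ-≤ 1 (*-monoʳ-≤ 6 (s≤s z≤n)))

  threeChromatic : ThreeChromatic steinerTripleSystem
  threeChromatic =
    (χ , χ-coloring) , λ (ψ , coloring) → ¬proper-2-coloring 5≤V ψ (coloring⇒proper coloring)

theorem3p4 : ∀ (n : ℕ) → n ≥ 1 →
    Σ (STS (6 * n + 1)) λ M → ThreeChromatic M × 𝒟≥ M (5 * n + 1)
theorem3p4 (suc k) _ =
  steinerTripleSystem , threeChromatic , χ , χ-coloring , S , S-minimal , ≤-reflexive (sym ∣S∣)
  where open SkolemTripleSystem k
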